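{- Let $G$ be a finite simple graph with $n=|V(G)|$, and let $T(G)$ be the graph obtained from $G$ by adding, for every vertex $v\in V(G)$, new vertices $a^v,b^v,c^v,d^v_i,e^v_i$ ($1\le i\le 2n+1$) and new edges $va^v$, $a^vb^v$, $vc^v$, $c^vd^v_i$, $d^v_ie^v_i$ ($1\le i\le 2n+1$). Then $\sigma(T(G))=2n-\alpha(G)$.
   Context: $\sigma(H)$ denotes the minimum cardinality of a maximal induced matching in $H$, where an induced matching (distance-2 matching) is a set of edges such that for any two distinct edges $e_1,e_2$ of the set, no endpoint of $e_1$ equals or is adjacent to an endpoint of $e_2$, and maximal means not contained in a larger induced matching. $\alpha(G)$ is the maximum size of an independent set in $G$. -}

module Defs where

open import Data.Nat using (ℕ; suc; _+_; _*_; _∸_; _≤_)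
open import Data.Fin using (Fin)
open import Data.List using (List; []; _∷_; length)
open import Data.List.Relation.Unary.AllPairs using (AllPairs)
open import Data.Product using (_×_; _,_; Σ-syntax)
open import Data.Sum using (_⊎_)
open import Relation.Nullary using (¬_; Dec)
open import Relation.Binary.PropositionalEquality using (_≢_)

record Graph (V : Set) : Set₁ where
  field
    Adj    : V → V → Set
    sym    : ∀ {x y} → Adj x y → Adj y x
    irrefl : ∀ {x} → ¬ Adj x x
    dec    : ∀ x y → Dec (Adj x y)

open Graph public

Far : ∀ {V} → Graph V → V → V → Set
Far H x y = x ≢ y × ¬ Adj H x y

IsIndependent : ∀ {V} → Graph V → List V → Set
IsIndependent H S = AllPairs (Far H) S

IsAlpha : ∀ {V} → Graph V → ℕ → Set
IsAlpha H k = (Σ[ S ∈ List _ ] (IsIndependent H S × length S ≡' k))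
              × (∀ S → IsIndependent H S → length S ≤ k)
  where
  open import Relation.Binary.PropositionalEquality renaming (_≡_ to _≡'_)

Separated : ∀ {V} → Graph V → V × V → V × V → Set
Separated H (u₁ , v₁) (u₂ , v₂) =
  Far H u₁ u₂ × Far H u₁ v₂ × Far H v₁ u₂ × Far H v₁ v₂

IsEdge : ∀ {V} → Graph V → V × V → Set
IsEdge H (u , v) = Adj H u v

-- Induced matching: a list of edges, pairwise separated
-- (hence in particular no edge is listed twice).
IsInducedMatching : ∀ {V} → Graph V → List (V × V) → Set
IsInducedMatching H M = Data.List.Relation.Unary.All.All (IsEdge H) M × AllPairs (Separated H) M
  where import Data.List.Relation.Unary.All

IsMaximalInducedMatching : ∀ {V} → Graph V → List (V × V) → Set
IsMaximalInducedMatching H M =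
  IsInducedMatching H M × (∀ u v → Adj H u v → ¬ IsInducedMatching H ((u , v) ∷ M))

IsSigma : ∀ {V} → Graph V → ℕ → Set
IsSigma H k = (Σ[ M ∈ List _ ] (IsMaximalInducedMatching H M × length M ≡' k))
              × (∀ M → IsMaximalInducedMatching H M → k ≤ length M)
  where
  open import Relation.Binary.PropositionalEquality renaming (_≡_ to _≡'_)

data TV (n : ℕ) : Set where
  orig : Fin n → TV n
  a b c : Fin n → TV n
  d e : Fin n → Fin (suc (2 * n)) → TV n   -- index i ∈ {1,…,2n+1} as Fin (2n+1)

data TE {n : ℕ} (G : Graph (Fin n)) : TV n → TV n → Set where
  old  : ∀ {u v} → Adj G u v → TE G (orig u) (orig v)
  va   : ∀ v → TE G (orig v) (a v)
  ab   : ∀ v → TE G (a v) (b v)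
  vc   : ∀ v → TE G (orig v) (c v)
  cd   : ∀ v i → TE G (c v) (d v i)
  de   : ∀ v i → TE G (d v i) (e v i)

private
  TE-irr : ∀ {n} {G : Graph (Fin n)} {x} → ¬ TE G x x
  TE-irr {G = G} (old p) = irrefl G p

  TE-dec : ∀ {n} (G : Graph (Fin n)) x y → Dec (TE G x y)
  TE-dec G x y = go x y
    where
    open import Relation.Nullary using (yes; no)
    open import Data.Fin.Properties using (_≟_)
    open import Relation.Binary.PropositionalEquality using (refl)
    go : ∀ x y → Dec (TE G x y)
    go (orig u) (orig v) with dec G u v
    ... | yes p = yes (old p)
    ... | no ¬p = no λ { (old p) → ¬p p }
    go (orig u) (a v) with u ≟ v
    ... | yes refl = yes (va u)
    ... | no ne = no λ { (va _) → ne refl }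
    go (orig u) (c v) with u ≟ v
    ... | yes refl = yes (vc u)
    ... | no ne = no λ { (vc _) → ne refl }
    go (a u) (b v) with u ≟ v
    ... | yes refl = yes (ab u)
    ... | no ne = no λ { (ab _) → ne refl }
    go (c u) (d v i) with u ≟ v
    ... | yes refl = yes (cd u i)
    ... | no ne = no λ { (cd _ _) → ne refl }
    go (d u i) (e v j) with u ≟ v | i ≟ j
    ... | yes refl | yes refl = yes (de u i)
    ... | no ne | _ = no λ { (de _ _) → ne refl }
    ... | _ | no ne = no λ { (de _ _) → ne refl }
    go (orig _) (b _) = no λ ()
    go (orig _) (d _ _) = no λ ()
    go (orig _) (e _ _) = no λ ()
    go (a _) (orig _) = no λ ()
    go (a _) (a _) = no λ ()
    go (a _) (c _) = no λ ()
    go (a _) (d _ _) = no λ ()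
    go (a _) (e _ _) = no λ ()
    go (b _) _ = no λ ()
    go (c _) (orig _) = no λ ()
    go (c _) (a _) = no λ ()
    go (c _) (b _) = no λ ()
    go (c _) (c _) = no λ ()
    go (c _) (e _ _) = no λ ()
    go (d _ _) (orig _) = no λ ()
    go (d _ _) (a _) = no λ ()
    go (d _ _) (b _) = no λ ()
    go (d _ _) (c _) = no λ ()
    go (d _ _) (d _ _) = no λ ()
    go (e _ _) _ = no λ ()

T : ∀ {n} → Graph (Fin n) → Graph (TV n)
T G = record
  { Adj = λ x y → TE G x y ⊎ TE G y x
  ; sym = λ { (inj₁ p) → inj₂ p ; (inj₂ p) → inj₁ p }
  ; irrefl = λ { (inj₁ p) → TE-irr p ; (inj₂ p) → TE-irr p }
  ; dec = λ x y → TE-dec G x y ⊎-dec TE-dec G y x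
  }
  where
  open Data.Sum using (inj₁; inj₂)
  open import Relation.Nullary.Decidable using (_⊎-dec_)

-- For a maximum independent set S of G, the edges v c^v (v ∈ S) together with a^v b^v and
-- c^v d^v_1 (v ∉ S) form an induced matching of size 2n − α(G) meeting the closed neighbourhood
-- of every edge, hence a maximal one.
-- Conversely let M be a maximal induced matching. If some c^v is not covered by M, each of the
-- 2n+1 edges d^v_i e^v_i is blocked by its own edge of M, so |M| > 2n. Otherwise every c^v lies on
-- an edge of M, distinct for distinct v; the vertices v whose edge is v c^v are independent, and for
-- each other v the edge a^v b^v is blocked by yet another edge of M at a^v or b^v. Charging these
-- 2n objects injectively to M ⊎ S gives |M| + α(G) ≥ 2n.

module Submission where

open import Defs hiding (sym; irrefl; dec)
open import Data.Nat using (ℕ; suc; _+_; _*_; _∸_; _≤_)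
open import Data.Nat.Properties
  using (≤-trans; ≤-reflexive; ≤-antisym; n≤1+n; m∸n≤m; ∸-monoʳ-≤; m≤n+o⇒m∸n≤o; m+n∸m≡n; +-suc; +-comm; +-identityʳ)
open import Data.Nat.Tactic.RingSolver using (solve-∀)
open import Data.Fin using (Fin; zero; suc; join; splitAt) renaming (_≟_ to _≟ᶠ_)
open import Data.Fin.Patterns using (0F; 1F; 2F; 3F; 4F; 5F)
open import Data.Fin.Properties using (injective⇒≤; join-splitAt; all?; ¬∀⟶∃¬)
open import Data.List using (List; []; _∷_; length; map; _++_; filter; allFin; lookup)
open import Data.List.Properties using (length-map; length-++; length-tabulate)
open import Data.List.Relation.Unary.All as All using (All; []; _∷_)
import Data.List.Relation.Unary.All.Properties as Allₚ
open import Data.List.Relation.Unary.Any using (Any; here; there; any?)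
open import Data.List.Relation.Unary.AllPairs as AllPairs using (AllPairs; []; _∷_)
import Data.List.Relation.Unary.AllPairs.Properties as AllPairsₚ
open import Data.List.Relation.Unary.Unique.Propositional using (Unique)
import Data.List.Relation.Unary.Unique.Propositional.Properties as Uniqueₚ
open import Data.List.Relation.Binary.Subset.Propositional using (_⊆_)
open import Data.List.Membership.Propositional using (_∈_; find; lose)
open import Data.List.Membership.Propositional.Properties
  using (∈-map⁺; ∈-++⁺ˡ; ∈-++⁺ʳ; ∈-filter⁺; ∈-filter⁻; ∈-allFin; ∈-lookup)
open import Data.List.Membership.Setoid.Properties using (index-injective)
open import Data.Product using (_×_; _,_; proj₁; proj₂; Σ-syntax)
import Data.Product.Properties as Productₚ
open import Data.Sum using (_⊎_; inj₁; inj₂; [_,_]′)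
open import Data.Empty using (⊥; ⊥-elim)
open import Data.Unit using (⊤; tt)
open import Function using (id)
open import Function.Definitions using (Injective)
open import Level using (0ℓ)
open import Relation.Nullary using (¬_; Dec; yes; no)
open import Relation.Nullary.Decidable using (map′; _⊎-dec_)
open import Relation.Unary using (Pred; Decidable)
open import Relation.Unary.Properties using (∁?)
open import Relation.Binary.Definitions using (DecidableEquality)
open import Relation.Binary.PropositionalEquality
  using (_≡_; _≢_; refl; sym; trans; cong; cong₂; subst; subst₂; setoid; ≢-sym; module ≡-Reasoning)

left-inverse⇒injective : ∀ {A B : Set} {f : A → B} (g : B → A) → (∀ x → g (f x) ≡ x) → Injective _≡_ _≡_ f
left-inverse⇒injective g gf {x} {y} fx≡fy = trans (sym (gf x)) (trans (cong g fx≡fy) (gf y))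

module _ {A : Set} where

  injection⇒≤length : ∀ {m} {xs : List A} {f : Fin m → A} →
    Injective _≡_ _≡_ f → (∀ i → f i ∈ xs) → m ≤ length xs
  injection⇒≤length f-inj f∈ =
    injective⇒≤ λ {i} {j} eq → f-inj (index-injective (setoid A) (f∈ i) (f∈ j) eq)

  Unique⇒lookup-injective : ∀ {xs : List A} → Unique xs → Injective _≡_ _≡_ (lookup xs)
  Unique⇒lookup-injective (_ ∷ _)    {zero}  {zero}  _  = refl
  Unique⇒lookup-injective (x∉ ∷ _)   {zero}  {suc j} eq = ⊥-elim (All.lookup x∉ (∈-lookup j) eq)
  Unique⇒lookup-injective (x∉ ∷ _)   {suc i} {zero}  eq = ⊥-elim (All.lookup x∉ (∈-lookup i) (sym eq))
  Unique⇒lookup-injective (_ ∷ uniq) {suc i} {suc j} eq = cong suc (Unique⇒lookup-injective uniq eq)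

  Unique-⊆⇒length≤ : ∀ {xs ys : List A} → Unique xs → xs ⊆ ys → length xs ≤ length ys
  Unique-⊆⇒length≤ uniq xs⊆ys =
    injection⇒≤length (Unique⇒lookup-injective uniq) (λ i → xs⊆ys (∈-lookup i))

  length-filter-∁ : ∀ {P : Pred A 0ℓ} (P? : Decidable P) xs →
    length (filter P? xs) + length (filter (∁? P?) xs) ≡ length xs
  length-filter-∁ P? [] = refl
  length-filter-∁ P? (x ∷ xs) with P? x
  ... | yes _ = cong suc (length-filter-∁ P? xs)
  ... | no  _ = trans (+-suc _ _) (cong suc (length-filter-∁ P? xs))

  AllPairs-∈ : ∀ {R : A → A → Set} {xs : List A} {x y : A} →
    AllPairs R xs → x ∈ xs → y ∈ xs → x ≡ y ⊎ R x y ⊎ R y x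
  AllPairs-∈ (_  ∷ _)   (here refl) (here refl) = inj₁ refl
  AllPairs-∈ (Rx ∷ _)   (here refl) (there y∈)  = inj₂ (inj₁ (All.lookup Rx y∈))
  AllPairs-∈ (Rx ∷ _)   (there x∈)  (here refl) = inj₂ (inj₂ (All.lookup Rx x∈))
  AllPairs-∈ (_  ∷ Rxs) (there x∈)  (there y∈)  = AllPairs-∈ Rxs x∈ y∈

  AllPairs-map-All : ∀ {R Q : A → A → Set} {P : A → Set} {xs : List A} →
    (∀ {x y} → P x → P y → R x y → Q x y) → All P xs → AllPairs R xs → AllPairs Q xs
  AllPairs-map-All f []         []         = []
  AllPairs-map-All f (px ∷ pxs) (Rx ∷ Rxs) =
    All.zipWith (λ (py , Rxy) → f px py Rxy) (pxs , Rx) ∷ AllPairs-map-All f pxs Rxs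

s+2r≡2n∸s : ∀ s r {n} → s + r ≡ n → s + (r + r) ≡ 2 * n ∸ s
s+2r≡2n∸s s r refl = sym (trans (cong (_∸ s) (double s r)) (m+n∸m≡n s (s + (r + r))))
  where
  double : ∀ s r → 2 * (s + r) ≡ s + (s + (r + r))
  double = solve-∀

n+n≤m+s⇒2n∸k≤m : ∀ n m s k → n + n ≤ m + s → s ≤ k → 2 * n ∸ k ≤ m
n+n≤m+s⇒2n∸k≤m n m s k n+n≤m+s s≤k = ≤-trans (∸-monoʳ-≤ (2 * n) s≤k)
  (m≤n+o⇒m∸n≤o (2 * n) s (subst₂ _≤_ (cong (n +_) (sym (+-identityʳ n))) (+-comm m s) n+n≤m+s))

module _ {n : ℕ} where
  open import Data.List.Membership.DecPropositional (_≟ᶠ_ {n}) using (_∈?_)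

  complement : List (Fin n) → List (Fin n)
  complement S = filter (∁? (_∈? S)) (allFin n)

  length-complement : ∀ {S : List (Fin n)} → Unique S → length S + length (complement S) ≡ n
  length-complement {S} uniq = trans (cong (_+ length (complement S)) (sym length-S′))
    (trans (length-filter-∁ (_∈? S) (allFin n)) (length-tabulate id))
    where
    S′ : List (Fin n)
    S′ = filter (_∈? S) (allFin n)
    length-S′ : length S′ ≡ length S
    length-S′ = ≤-antisym
      (Unique-⊆⇒length≤ (Uniqueₚ.filter⁺ (_∈? S) (Uniqueₚ.allFin⁺ n))
        (λ v∈S′ → proj₂ (∈-filter⁻ (_∈? S) {xs = allFin n} v∈S′)))
      (Unique-⊆⇒length≤ uniq (λ v∈S → ∈-filter⁺ (_∈? S) (∈-allFin _) v∈S))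

Endpoint : ∀ {V : Set} → V → V × V → Set
Endpoint x (u , w) = x ≡ u ⊎ x ≡ w

endpoint? : ∀ {V : Set} → DecidableEquality V → ∀ x ε → Dec (Endpoint {V} x ε)
endpoint? _≟_ x (u , w) = (x ≟ u) ⊎-dec (x ≟ w)

module _ {V : Set} (H : Graph V) where

  far-sym : ∀ {x y} → Far H x y → Far H y x
  far-sym (x≢y , ¬xy) = ≢-sym x≢y , λ yx → ¬xy (Graph.sym H yx)

  separated⇒far : ∀ {ε ε′ x y} → Separated H ε ε′ → Endpoint x ε → Endpoint y ε′ → Far H x y
  separated⇒far {_ , _} {_ , _} (f₁ , _  , _  , _ ) (inj₁ refl) (inj₁ refl) = f₁
  separated⇒far {_ , _} {_ , _} (_  , f₂ , _  , _ ) (inj₁ refl) (inj₂ refl) = f₂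
  separated⇒far {_ , _} {_ , _} (_  , _  , f₃ , _ ) (inj₂ refl) (inj₁ refl) = f₃
  separated⇒far {_ , _} {_ , _} (_  , _  , _  , f₄) (inj₂ refl) (inj₂ refl) = f₄

  near-endpoints⇒same-edge : ∀ {M ε ε′ x y} → IsInducedMatching H M → ε ∈ M → ε′ ∈ M →
    Endpoint x ε → Endpoint y ε′ → x ≡ y ⊎ Adj H x y → ε ≡ ε′
  near-endpoints⇒same-edge (_ , separated) ε∈ ε′∈ x∈ε y∈ε′ near
    with AllPairs-∈ separated ε∈ ε′∈
  ... | inj₁ ε≡ε′ = ε≡ε′
  ... | inj₂ (inj₁ s) = let (x≢y , ¬xy) = separated⇒far s x∈ε y∈ε′ in ⊥-elim ([ x≢y , ¬xy ]′ near)
  ... | inj₂ (inj₂ s) = let (x≢y , ¬xy) = far-sym (separated⇒far s y∈ε′ x∈ε) in ⊥-elim ([ x≢y , ¬xy ]′ near)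

  edge-endpoints-adjacent : ∀ {ε x y} → IsEdge H ε → Endpoint x ε → Endpoint y ε → x ≢ y → Adj H x y
  edge-endpoints-adjacent {_ , _} _  (inj₁ refl) (inj₁ refl) x≢y = ⊥-elim (x≢y refl)
  edge-endpoints-adjacent {_ , _} uw (inj₁ refl) (inj₂ refl) _   = uw
  edge-endpoints-adjacent {_ , _} uw (inj₂ refl) (inj₁ refl) _   = Graph.sym H uw
  edge-endpoints-adjacent {_ , _} _  (inj₂ refl) (inj₂ refl) x≢y = ⊥-elim (x≢y refl)

  Near : V → V → V → Set
  Near u w x = x ≡ u ⊎ x ≡ w ⊎ Adj H u x ⊎ Adj H w x

  Dominated : List (V × V) → V → V → Set
  Dominated M u w = Σ[ ε ∈ V × V ] (ε ∈ M × Σ[ x ∈ V ] (Endpoint x ε × Near u w x))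

  dominated-sym : ∀ {M u w} → Dominated M u w → Dominated M w u
  dominated-sym (ε , ε∈ , x , x∈ε , inj₁ x≡u)                = ε , ε∈ , x , x∈ε , inj₂ (inj₁ x≡u)
  dominated-sym (ε , ε∈ , x , x∈ε , inj₂ (inj₁ x≡w))         = ε , ε∈ , x , x∈ε , inj₁ x≡w
  dominated-sym (ε , ε∈ , x , x∈ε , inj₂ (inj₂ (inj₁ ux)))   = ε , ε∈ , x , x∈ε , inj₂ (inj₂ (inj₂ ux))
  dominated-sym (ε , ε∈ , x , x∈ε , inj₂ (inj₂ (inj₂ wx)))   = ε , ε∈ , x , x∈ε , inj₂ (inj₂ (inj₁ wx))

  near⇒¬separated : ∀ {u w ε x} → Separated H (u , w) ε → Endpoint x ε → ¬ Near u w x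
  near⇒¬separated s x∈ε (inj₁ refl)                = proj₁ (separated⇒far s (inj₁ refl) x∈ε) refl
  near⇒¬separated s x∈ε (inj₂ (inj₁ refl))         = proj₁ (separated⇒far s (inj₂ refl) x∈ε) refl
  near⇒¬separated s x∈ε (inj₂ (inj₂ (inj₁ ux)))    = proj₂ (separated⇒far s (inj₁ refl) x∈ε) ux
  near⇒¬separated s x∈ε (inj₂ (inj₂ (inj₂ wx)))    = proj₂ (separated⇒far s (inj₂ refl) x∈ε) wx

  ¬near⇒separated : ∀ {u w ε} → (∀ {x} → Endpoint x ε → ¬ Near u w x) → Separated H (u , w) ε
  ¬near⇒separated {u} {w} {p , q} ¬near =
    far-from (inj₁ refl) near-u , far-from (inj₂ refl) near-u ,
    far-from (inj₁ refl) near-w , far-from (inj₂ refl) near-w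
    where
    far-from : ∀ {z y} → Endpoint y (p , q) → (∀ {x} → x ≡ z ⊎ Adj H z x → Near u w x) → Far H z y
    far-from y∈ε near = (λ z≡y → ¬near y∈ε (near (inj₁ (sym z≡y)))) , λ zy → ¬near y∈ε (near (inj₂ zy))
    near-u : ∀ {x} → x ≡ u ⊎ Adj H u x → Near u w x
    near-u = [ inj₁ , (λ ux → inj₂ (inj₂ (inj₁ ux))) ]′
    near-w : ∀ {x} → x ≡ w ⊎ Adj H w x → Near u w x
    near-w = [ (λ x≡w → inj₂ (inj₁ x≡w)) , (λ wx → inj₂ (inj₂ (inj₂ wx))) ]′

  dominating⇒maximal : ∀ {M} → IsInducedMatching H M → (∀ u w → Adj H u w → Dominated M u w) →
    IsMaximalInducedMatching H M
  dominating⇒maximal im dominating = im , λ { u w uw (_ , (s ∷ _)) →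
    let (ε , ε∈ , x , x∈ε , near) = dominating u w uw in
    near⇒¬separated (All.lookup s ε∈) x∈ε near }

  -- N enumerates the closed neighbourhood of uw; this makes the search for a blocking edge decidable.
  maximal⇒dominated : DecidableEquality V → ∀ {M u w} → IsMaximalInducedMatching H M → Adj H u w →
    (N : List V) → (∀ {x} → Near u w x → x ∈ N) →
    Σ[ ε ∈ V × V ] (ε ∈ M × Σ[ x ∈ V ] (x ∈ N × Endpoint x ε))
  maximal⇒dominated _≟_ {M} {u} {w} ((edges , separated) , maximal) uw N cover
    with any? (λ ε → any? (λ x → endpoint? _≟_ x ε) N) M
  ... | yes hit = let (ε , ε∈ , x-hit) = find hit ; (x , x∈ , x∈ε) = find x-hit in ε , ε∈ , x , x∈ , x∈ε
  ... | no miss = ⊥-elim (maximal u w uw (uw ∷ edges , All.tabulate separated-from ∷ separated))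
    where
    separated-from : ∀ {ε} → ε ∈ M → Separated H (u , w) ε
    separated-from ε∈ = ¬near⇒separated λ x∈ε near → miss (lose ε∈ (lose (cover near) x∈ε))

module _ {n : ℕ} where

  owner : TV n → Fin n
  owner (orig v) = v
  owner (a v)    = v
  owner (b v)    = v
  owner (c v)    = v
  owner (d v _)  = v
  owner (e v _)  = v

  -- the index i of d^v_i and e^v_i; a junk 0F elsewhere
  branch : TV n → Fin (suc (2 * n))
  branch (d _ i) = i
  branch (e _ i) = i
  branch _       = 0F

  Pendant : TV n → Set
  Pendant (orig _) = ⊥
  Pendant _        = ⊤

  private
    kind : TV n → Fin 6
    kind (orig _) = 0F
    kind (a _)    = 1F
    kind (b _)    = 2F
    kind (c _)    = 3F
    kind (d _ _)  = 4F
    kind (e _ _)  = 5F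

    encode : TV n → Fin 6 × Fin n × Fin (suc (2 * n))
    encode x = kind x , owner x , branch x

    decode : Fin 6 × Fin n × Fin (suc (2 * n)) → TV n
    decode (0F , v , _) = orig v
    decode (1F , v , _) = a v
    decode (2F , v , _) = b v
    decode (3F , v , _) = c v
    decode (4F , v , i) = d v i
    decode (5F , v , i) = e v i

    decode-encode : ∀ x → decode (encode x) ≡ x
    decode-encode (orig _) = refl
    decode-encode (a _)    = refl
    decode-encode (b _)    = refl
    decode-encode (c _)    = refl
    decode-encode (d _ _)  = refl
    decode-encode (e _ _)  = refl

  _≟ᵥ_ : DecidableEquality (TV n)
  x ≟ᵥ y = map′ (left-inverse⇒injective decode decode-encode) (cong encode)
    (Productₚ.≡-dec _≟ᶠ_ (Productₚ.≡-dec _≟ᶠ_ _≟ᶠ_) (encode x) (encode y))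

module _ {n : ℕ} (G : Graph (Fin n)) where

  adjacent-pendant⇒same-owner : ∀ {x y} → Adj (T G) x y → Pendant y → owner x ≡ owner y
  adjacent-pendant⇒same-owner (inj₁ (old _))  ()
  adjacent-pendant⇒same-owner (inj₁ (va _))   _ = refl
  adjacent-pendant⇒same-owner (inj₁ (ab _))   _ = refl
  adjacent-pendant⇒same-owner (inj₁ (vc _))   _ = refl
  adjacent-pendant⇒same-owner (inj₁ (cd _ _)) _ = refl
  adjacent-pendant⇒same-owner (inj₁ (de _ _)) _ = refl
  adjacent-pendant⇒same-owner (inj₂ (old _))  ()
  adjacent-pendant⇒same-owner (inj₂ (va _))   _ = refl
  adjacent-pendant⇒same-owner (inj₂ (ab _))   _ = refl
  adjacent-pendant⇒same-owner (inj₂ (vc _))   _ = refl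
  adjacent-pendant⇒same-owner (inj₂ (cd _ _)) _ = refl
  adjacent-pendant⇒same-owner (inj₂ (de _ _)) _ = refl

  edge-owner : ∀ {x y z} → IsEdge (T G) (x , y) → Endpoint z (x , y) → Pendant z → owner x ≡ owner z
  edge-owner _  (inj₁ refl) _ = refl
  edge-owner xy (inj₂ refl) p = adjacent-pendant⇒same-owner xy p

  far-by-owner : ∀ {x y} → owner x ≢ owner y → Pendant y → Far (T G) x y
  far-by-owner owners≢ p = (λ x≡y → owners≢ (cong owner x≡y)) , λ xy → owners≢ (adjacent-pendant⇒same-owner xy p)

  far-orig : ∀ {u v} → Far G u v → Far (T G) (orig u) (orig v)
  far-orig (u≢v , ¬uv) = (λ { refl → u≢v refl }) , λ { (inj₁ (old uv)) → ¬uv uv ; (inj₂ (old vu)) → ¬uv (Graph.sym G vu) }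

  far-unrelated : ∀ {x y} → x ≢ y → ¬ TE G x y → ¬ TE G y x → Far (T G) x y
  far-unrelated x≢y ¬xy ¬yx = x≢y , [ ¬xy , ¬yx ]′

data Choice (n : ℕ) : Set where
  inS outAB outCD : Fin n → Choice n

module MatchingFromIndependentSet {n : ℕ} (G : Graph (Fin n))
  (S : List (Fin n)) (S-independent : IsIndependent G S) where
  open import Data.List.Membership.DecPropositional (_≟ᶠ_ {n}) using (_∈?_)

  edgeOf : Choice n → TV n × TV n
  edgeOf (inS v)   = orig v , c v
  edgeOf (outAB v) = a v , b v
  edgeOf (outCD v) = c v , d v 0F

  Compatible : Choice n → Choice n → Set
  Compatible (inS v)   (inS w)   = Far G v w
  Compatible (inS v)   (outAB w) = v ≢ w
  Compatible (inS v)   (outCD w) = v ≢ w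
  Compatible (outAB v) (outAB w) = v ≢ w
  Compatible (outAB _) (outCD _) = ⊤
  Compatible (outCD v) (outCD w) = v ≢ w
  Compatible _         _         = ⊥

  compatible⇒separated : ∀ {t t′} → Compatible t t′ → Separated (T G) (edgeOf t) (edgeOf t′)
  compatible⇒separated {inS v} {inS w} vw@(v≢w , _) =
    far-orig G vw , far-by-owner G v≢w tt ,
    far-sym (T G) (far-by-owner G (≢-sym v≢w) tt) , far-by-owner G v≢w tt
  compatible⇒separated {inS _} {outAB _} v≢w =
    far-by-owner G v≢w tt , far-by-owner G v≢w tt , far-by-owner G v≢w tt , far-by-owner G v≢w tt
  compatible⇒separated {inS _} {outCD _} v≢w =
    far-by-owner G v≢w tt , far-by-owner G v≢w tt , far-by-owner G v≢w tt , far-by-owner G v≢w tt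
  compatible⇒separated {outAB _} {outAB _} v≢w =
    far-by-owner G v≢w tt , far-by-owner G v≢w tt , far-by-owner G v≢w tt , far-by-owner G v≢w tt
  compatible⇒separated {outAB _} {outCD _} _ =
    far-unrelated G (λ ()) (λ ()) (λ ()) , far-unrelated G (λ ()) (λ ()) (λ ()) ,
    far-unrelated G (λ ()) (λ ()) (λ ()) , far-unrelated G (λ ()) (λ ()) (λ ())
  compatible⇒separated {outCD _} {outCD _} v≢w =
    far-by-owner G v≢w tt , far-by-owner G v≢w tt , far-by-owner G v≢w tt , far-by-owner G v≢w tt

  edgeOf-edge : ∀ t → IsEdge (T G) (edgeOf t)
  edgeOf-edge (inS v)   = inj₁ (vc v)
  edgeOf-edge (outAB v) = inj₁ (ab v)
  edgeOf-edge (outCD v) = inj₁ (cd v 0F)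

  R : List (Fin n)
  R = complement S

  choices : List (Choice n)
  choices = map inS S ++ map outAB R ++ map outCD R

  compatible-choices : AllPairs Compatible choices
  compatible-choices =
    AllPairsₚ.++⁺ (AllPairsₚ.map⁺ S-independent)
      (AllPairsₚ.++⁺ (AllPairsₚ.map⁺ R-unique) (AllPairsₚ.map⁺ R-unique)
        (Allₚ.map⁺ (All.universal (λ _ → Allₚ.map⁺ (All.universal (λ _ → tt) R)) R)))
      (Allₚ.map⁺ (All.tabulate λ v∈S → Allₚ.++⁺ (Allₚ.map⁺ (All.tabulate (S∌R v∈S)))
                                               (Allₚ.map⁺ (All.tabulate (S∌R v∈S)))))
    where
    R-unique : Unique R
    R-unique = Uniqueₚ.filter⁺ _ (Uniqueₚ.allFin⁺ n)
    S∌R : ∀ {v w} → v ∈ S → w ∈ R → v ≢ w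
    S∌R v∈S w∈R refl = proj₂ (∈-filter⁻ (∁? (_∈? S)) {xs = allFin n} w∈R) v∈S

  M : List (TV n × TV n)
  M = map edgeOf choices

  M-induced : IsInducedMatching (T G) M
  M-induced = Allₚ.map⁺ (All.universal edgeOf-edge choices) ,
              AllPairsₚ.map⁺ (AllPairs.map compatible⇒separated compatible-choices)

  inS∈M : ∀ {v} → v ∈ S → (orig v , c v) ∈ M
  inS∈M v∈S = ∈-map⁺ edgeOf (∈-++⁺ˡ (∈-map⁺ inS v∈S))

  outAB∈M : ∀ {v} → ¬ v ∈ S → (a v , b v) ∈ M
  outAB∈M v∉S = ∈-map⁺ edgeOf (∈-++⁺ʳ (map inS S) (∈-++⁺ˡ (∈-map⁺ outAB (∈-filter⁺ _ (∈-allFin _) v∉S))))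

  outCD∈M : ∀ {v} → ¬ v ∈ S → (c v , d v 0F) ∈ M
  outCD∈M v∉S = ∈-map⁺ edgeOf (∈-++⁺ʳ (map inS S) (∈-++⁺ʳ (map outAB R) (∈-map⁺ outCD (∈-filter⁺ _ (∈-allFin _) v∉S))))

  dominated : ∀ {x y} → TE G x y → Dominated (T G) M x y
  dominated (old {v} _) with v ∈? S
  ... | yes v∈S = _ , inS∈M v∈S , orig v , inj₁ refl , inj₁ refl
  ... | no  v∉S = _ , outAB∈M v∉S , a v , inj₁ refl , inj₂ (inj₂ (inj₁ (inj₁ (va v))))
  dominated (va v) with v ∈? S
  ... | yes v∈S = _ , inS∈M v∈S , orig v , inj₁ refl , inj₁ refl
  ... | no  v∉S = _ , outAB∈M v∉S , a v , inj₁ refl , inj₂ (inj₁ refl)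
  dominated (ab v) with v ∈? S
  ... | yes v∈S = _ , inS∈M v∈S , orig v , inj₁ refl , inj₂ (inj₂ (inj₁ (inj₂ (va v))))
  ... | no  v∉S = _ , outAB∈M v∉S , a v , inj₁ refl , inj₁ refl
  dominated (vc v) with v ∈? S
  ... | yes v∈S = _ , inS∈M v∈S , orig v , inj₁ refl , inj₁ refl
  ... | no  v∉S = _ , outCD∈M v∉S , c v , inj₁ refl , inj₂ (inj₁ refl)
  dominated (cd v _) with v ∈? S
  ... | yes v∈S = _ , inS∈M v∈S , c v , inj₂ refl , inj₁ refl
  ... | no  v∉S = _ , outCD∈M v∉S , c v , inj₁ refl , inj₁ refl
  dominated (de v i) with v ∈? S
  ... | yes v∈S = _ , inS∈M v∈S , c v , inj₂ refl , inj₂ (inj₂ (inj₁ (inj₂ (cd v i))))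
  ... | no  v∉S = _ , outCD∈M v∉S , c v , inj₁ refl , inj₂ (inj₂ (inj₁ (inj₂ (cd v i))))

  M-maximal : IsMaximalInducedMatching (T G) M
  M-maximal = dominating⇒maximal (T G) M-induced λ where
    _ _ (inj₁ xy) → dominated xy
    _ _ (inj₂ yx) → dominated-sym (T G) (dominated yx)

  length-M : length M ≡ 2 * n ∸ length S
  length-M = begin
    length M                                   ≡⟨ length-map edgeOf choices ⟩
    length choices                             ≡⟨ length-choices ⟩
    length S + (length R + length R)           ≡⟨ s+2r≡2n∸s (length S) (length R) S+R≡n ⟩
    2 * n ∸ length S                           ∎
    where
    open ≡-Reasoning
    S+R≡n : length S + length R ≡ n
    S+R≡n = length-complement (AllPairs.map proj₁ S-independent)
    length-choices : length choices ≡ length S + (length R + length R)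
    length-choices = trans (length-++ (map inS S))
      (cong₂ _+_ (length-map inS S)
        (trans (length-++ (map outAB R)) (cong₂ _+_ (length-map outAB R) (length-map outCD R))))

module LowerBound {n : ℕ} (G : Graph (Fin n)) {M : List (TV n × TV n)}
  (M-maximal : IsMaximalInducedMatching (T G) M) where

  M-induced : IsInducedMatching (T G) M
  M-induced = proj₁ M-maximal

  edge∈M : ∀ {ε} → ε ∈ M → IsEdge (T G) ε
  edge∈M = All.lookup (proj₁ M-induced)

  HubCovered : Fin n → Set
  HubCovered v = Any (Endpoint (c v)) M

  hubCovered? : ∀ v → Dec (HubCovered v)
  hubCovered? v = any? (endpoint? _≟ᵥ_ (c v)) M

  uncovered-hub⇒long : ∀ {v} → ¬ HubCovered v → suc (2 * n) ≤ length M
  uncovered-hub⇒long {v} uncovered =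
    injection⇒≤length (left-inverse⇒injective (λ ε → branch (proj₁ ε)) branch-blocker)
      (λ i → proj₁ (proj₂ (blocked i)))
    where
    leg : Fin (suc (2 * n)) → List (TV n)
    leg i = c v ∷ d v i ∷ e v i ∷ []

    near-leg : ∀ {i x} → Near (T G) (d v i) (e v i) x → x ∈ leg i
    near-leg (inj₁ refl)                               = there (here refl)
    near-leg (inj₂ (inj₁ refl))                        = there (there (here refl))
    near-leg (inj₂ (inj₂ (inj₁ (inj₁ (de _ _)))))      = there (there (here refl))
    near-leg (inj₂ (inj₂ (inj₁ (inj₂ (cd _ _)))))      = here refl
    near-leg (inj₂ (inj₂ (inj₂ (inj₁ ()))))
    near-leg (inj₂ (inj₂ (inj₂ (inj₂ (de _ _)))))      = there (here refl)

    blocked : ∀ i → Σ[ ε ∈ TV n × TV n ] (ε ∈ M × Σ[ x ∈ TV n ] (x ∈ leg i × Endpoint x ε))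
    blocked i = maximal⇒dominated (T G) _≟ᵥ_ M-maximal (inj₁ (de v i)) (leg i) near-leg

    leg-edge-branch : ∀ {i ε x} → IsEdge (T G) ε → ¬ Endpoint (c v) ε → x ∈ leg i → Endpoint x ε →
      branch (proj₁ ε) ≡ i
    leg-edge-branch {ε = _ , _} _              c∉ε (here refl)                 x∈ε         = ⊥-elim (c∉ε x∈ε)
    leg-edge-branch {ε = _ , _} _              _   (there (here refl))         (inj₁ refl) = refl
    leg-edge-branch {ε = _ , _} (inj₁ (cd _ _)) c∉ε (there (here refl))        (inj₂ refl) = ⊥-elim (c∉ε (inj₁ refl))
    leg-edge-branch {ε = _ , _} (inj₂ (de _ _)) _   (there (here refl))        (inj₂ refl) = refl
    leg-edge-branch {ε = _ , _} _              _   (there (there (here refl))) (inj₁ refl) = refl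
    leg-edge-branch {ε = _ , _} (inj₁ (de _ _)) _   (there (there (here refl))) (inj₂ refl) = refl
    leg-edge-branch {ε = _ , _} (inj₂ ())      _   (there (there (here refl))) (inj₂ refl)

    branch-blocker : ∀ i → branch (proj₁ (proj₁ (blocked i))) ≡ i
    branch-blocker i with blocked i
    ... | ε , ε∈ , _ , x∈leg , x∈ε = leg-edge-branch (edge∈M ε∈) (λ c∈ε → uncovered (lose ε∈ c∈ε)) x∈leg x∈ε

  module CoveredHubs (covered : ∀ v → HubCovered v) where

    hubEdge : Fin n → TV n × TV n
    hubEdge v = proj₁ (find (covered v))

    hubEdge∈M : ∀ v → hubEdge v ∈ M
    hubEdge∈M v = proj₁ (proj₂ (find (covered v)))

    hub∈hubEdge : ∀ v → Endpoint (c v) (hubEdge v)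
    hub∈hubEdge v = proj₂ (proj₂ (find (covered v)))

    owner-hubEdge : ∀ v → owner (proj₁ (hubEdge v)) ≡ v
    owner-hubEdge v = edge-owner G (edge∈M (hubEdge∈M v)) (hub∈hubEdge v) tt

    hubEdge-injective : Injective _≡_ _≡_ hubEdge
    hubEdge-injective = left-inverse⇒injective (λ ε → owner (proj₁ ε)) owner-hubEdge

    OrigOnHubEdge : Fin n → Set
    OrigOnHubEdge v = Endpoint (orig v) (hubEdge v)

    origOnHubEdge? : ∀ v → Dec (OrigOnHubEdge v)
    origOnHubEdge? v = endpoint? _≟ᵥ_ (orig v) (hubEdge v)

    S : List (Fin n)
    S = filter origOnHubEdge? (allFin n)

    S-independent : IsIndependent G S
    S-independent = AllPairs-map-All far (Allₚ.all-filter origOnHubEdge? (allFin n))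
                                         (AllPairsₚ.filter⁺ origOnHubEdge? (Uniqueₚ.allFin⁺ n))
      where
      far : ∀ {v w} → OrigOnHubEdge v → OrigOnHubEdge w → v ≢ w → Far G v w
      far {v} {w} v∈ w∈ v≢w = v≢w , λ vw → v≢w (hubEdge-injective
        (near-endpoints⇒same-edge (T G) M-induced (hubEdge∈M v) (hubEdge∈M w) v∈ w∈ (inj₂ (inj₁ (old vw)))))

    Item : Set
    Item = (TV n × TV n) ⊎ Fin n

    items : List Item
    items = map inj₁ M ++ map inj₂ S

    -- The second item charged to v: v itself when v ∈ S, otherwise an edge of M blocking a^v b^v.
    SecondCharge : Fin n → Item → Set
    SecondCharge v (inj₁ ε) = ε ∈ M × (Endpoint (a v) ε ⊎ Endpoint (b v) ε)
    SecondCharge v (inj₂ w) = w ≡ v × OrigOnHubEdge v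

    near-ab : ∀ {v x} → Near (T G) (a v) (b v) x → x ∈ orig v ∷ a v ∷ b v ∷ []
    near-ab (inj₁ refl)                          = there (here refl)
    near-ab (inj₂ (inj₁ refl))                   = there (there (here refl))
    near-ab (inj₂ (inj₂ (inj₁ (inj₁ (ab _)))))   = there (there (here refl))
    near-ab (inj₂ (inj₂ (inj₁ (inj₂ (va _)))))   = here refl
    near-ab (inj₂ (inj₂ (inj₂ (inj₁ ()))))
    near-ab (inj₂ (inj₂ (inj₂ (inj₂ (ab _)))))   = there (here refl)

    secondCharge : ∀ v → Σ[ t ∈ Item ] SecondCharge v t
    secondCharge v with origOnHubEdge? v
    ... | yes orig∈hub = inj₂ v , refl , orig∈hub
    ... | no  orig∉hub with maximal⇒dominated (T G) _≟ᵥ_ M-maximal (inj₁ (ab v)) _ near-ab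
    ...   | ε , ε∈ , _ , here refl , orig∈ε = ⊥-elim (orig∉hub (subst (Endpoint (orig v))
            (near-endpoints⇒same-edge (T G) M-induced ε∈ (hubEdge∈M v) orig∈ε (hub∈hubEdge v) (inj₂ (inj₁ (vc v))))
            orig∈ε))
    ...   | ε , ε∈ , _ , there (here refl)         , a∈ε = inj₁ ε , ε∈ , inj₁ a∈ε
    ...   | ε , ε∈ , _ , there (there (here refl)) , b∈ε = inj₁ ε , ε∈ , inj₂ b∈ε

    charge : Fin n ⊎ Fin n → Item
    charge (inj₁ v) = inj₁ (hubEdge v)
    charge (inj₂ v) = proj₁ (secondCharge v)

    charge∈items : ∀ s → charge s ∈ items
    charge∈items (inj₁ v) = ∈-++⁺ˡ (∈-map⁺ inj₁ (hubEdge∈M v))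
    charge∈items (inj₂ v) with secondCharge v
    ... | inj₁ ε , ε∈ , _          = ∈-++⁺ˡ (∈-map⁺ inj₁ ε∈)
    ... | inj₂ _ , refl , orig∈hub = ∈-++⁺ʳ (map inj₁ M) (∈-map⁺ inj₂ (∈-filter⁺ origOnHubEdge? (∈-allFin _) orig∈hub))

    itemOwner : Item → Fin n
    itemOwner (inj₁ ε) = owner (proj₁ ε)
    itemOwner (inj₂ w) = w

    owner-charge : ∀ s → itemOwner (charge s) ≡ [ id , id ]′ s
    owner-charge (inj₁ v) = owner-hubEdge v
    owner-charge (inj₂ v) with secondCharge v
    ... | inj₁ _ , ε∈ , inj₁ a∈ε = edge-owner G (edge∈M ε∈) a∈ε tt
    ... | inj₁ _ , ε∈ , inj₂ b∈ε = edge-owner G (edge∈M ε∈) b∈ε tt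
    ... | inj₂ _ , refl , _      = refl

    hubCharge≢secondCharge : ∀ v w → charge (inj₁ v) ≢ charge (inj₂ w)
    hubCharge≢secondCharge v w eq with secondCharge w | eq
    ... | inj₁ _ , ε∈ , a∈ε⊎b∈ε | refl = pendants-apart a∈ε⊎b∈ε
      where
      pendants-apart : ¬ (Endpoint (a w) (hubEdge v) ⊎ Endpoint (b w) (hubEdge v))
      pendants-apart (inj₁ a∈ε) with edge-endpoints-adjacent (T G) (edge∈M ε∈) (hub∈hubEdge v) a∈ε (λ ())
      ... | inj₁ ()
      ... | inj₂ ()
      pendants-apart (inj₂ b∈ε) with edge-endpoints-adjacent (T G) (edge∈M ε∈) (hub∈hubEdge v) b∈ε (λ ())
      ... | inj₁ ()
      ... | inj₂ ()

    same-charge⇒same-vertex : ∀ {s s′} → charge s ≡ charge s′ → [ id , id ]′ s ≡ [ id , id ]′ s′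
    same-charge⇒same-vertex {s} {s′} eq = trans (sym (owner-charge s)) (trans (cong itemOwner eq) (owner-charge s′))

    charge-injective : Injective _≡_ _≡_ charge
    charge-injective {inj₁ v} {inj₁ w} eq = cong inj₁ (same-charge⇒same-vertex {inj₁ v} {inj₁ w} eq)
    charge-injective {inj₁ v} {inj₂ w} eq = ⊥-elim (hubCharge≢secondCharge v w eq)
    charge-injective {inj₂ v} {inj₁ w} eq = ⊥-elim (hubCharge≢secondCharge w v (sym eq))
    charge-injective {inj₂ v} {inj₂ w} eq = cong inj₂ (same-charge⇒same-vertex {inj₂ v} {inj₂ w} eq)

    n+n≤length-M+length-S : n + n ≤ length M + length S
    n+n≤length-M+length-S = ≤-trans
      (injection⇒≤length (λ eq → splitAt-injective (charge-injective eq)) (λ i → charge∈items (splitAt n i)))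
      (≤-reflexive (trans (length-++ (map inj₁ M)) (cong₂ _+_ (length-map inj₁ M) (length-map inj₂ S))))
      where
      splitAt-injective : Injective _≡_ _≡_ (splitAt n {n})
      splitAt-injective = left-inverse⇒injective (join n n) (join-splitAt n n)

  length-M-lower-bound : ∀ {k} → (∀ S → IsIndependent G S → length S ≤ k) → 2 * n ∸ k ≤ length M
  length-M-lower-bound {k} α-max with all? hubCovered?
  ... | yes covered = let open CoveredHubs covered in
        n+n≤m+s⇒2n∸k≤m n (length M) (length S) k n+n≤length-M+length-S (α-max S S-independent)
  ... | no ¬covered = let (_ , uncovered) = ¬∀⟶∃¬ n HubCovered hubCovered? ¬covered in
        ≤-trans (m∸n≤m (2 * n) k) (≤-trans (n≤1+n (2 * n)) (uncovered-hub⇒long uncovered))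

theorem7 : (n : ℕ) (G : Graph (Fin n)) (k : ℕ) → IsAlpha G k → IsSigma (T G) (2 * n ∸ k)
theorem7 n G k ((S , S-independent , refl) , α-max) =
  (M , M-maximal , length-M) , λ M′ M′-maximal → LowerBound.length-M-lower-bound G M′-maximal α-max
  where open MatchingFromIndependentSet G S S-independent
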